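{- For every Bochvar algebra $\mathbf{A}$, its $\{J_0,J_1,J_2\}$-free reduct $\langle A,\wedge,\vee,\neg,0,1\rangle$ belongs to $\mathsf{SIBSL}$.
   Context: Let $\mathbf{WK}^e=\langle\{0,\tfrac12,1\},\neg,\vee,\wedge,J_0,J_1,J_2,0,1\rangle$ be the algebra where $\neg 1=0$, $\neg\tfrac12=\tfrac12$, $\neg 0=1$; $x\vee y$ and $x\wedge y$ equal $\tfrac12$ whenever one argument is $\tfrac12$ and are the Boolean join/meet on $\{0,1\}$ otherwise; $J_0(0)=1$, $J_0(\tfrac12)=J_0(1)=0$; $J_1(\tfrac12)=1$, $J_1(0)=J_1(1)=0$; $J_2(1)=1$, $J_2(0)=J_2(\tfrac12)=0$. The quasivariety $\mathsf{BCA}$ of Bochvar algebras (Finn–Grigolia) is the quasivariety generated by $\mathbf{WK}^e$, i.e. $\mathsf{BCA}=ISP(\mathbf{WK}^e)$. Let $\mathbf{WK}$ be the $\{J_0,J_1,J_2\}$-free reduct of $\mathbf{WK}^e$. $\mathsf{SIBSL}$ (single-fixpoint involutive bisemilattices) is the quasivariety generated by $\mathbf{WK}$, i.e. $ISPP_u(\mathbf{WK})$. -}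

module Defs where

open import Level using (Level; _⊔_; suc; Lift)
open import Data.Unit using () renaming (⊤ to ⊤')
open import Relation.Binary.PropositionalEquality using (_≡_)
open import Relation.Binary.Structures using (IsEquivalence)
open import Relation.Nullary using (¬_)
open import Data.Product using (_×_; Σ)
open import Data.Sum using (_⊎_)
open import Data.Empty using (⊥)

data Three : Set where
  𝟘 ½ 𝟙 : Three

¬₃ : Three → Three
¬₃ 𝟘 = 𝟙
¬₃ ½ = ½
¬₃ 𝟙 = 𝟘

_∨₃_ : Three → Three → Three
½ ∨₃ y = ½
𝟘 ∨₃ ½ = ½
𝟙 ∨₃ ½ = ½
𝟘 ∨₃ 𝟘 = 𝟘
𝟘 ∨₃ 𝟙 = 𝟙
𝟙 ∨₃ 𝟘 = 𝟙
𝟙 ∨₃ 𝟙 = 𝟙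

_∧₃_ : Three → Three → Three
½ ∧₃ y = ½
𝟘 ∧₃ ½ = ½
𝟙 ∧₃ ½ = ½
𝟘 ∧₃ 𝟘 = 𝟘
𝟘 ∧₃ 𝟙 = 𝟘
𝟙 ∧₃ 𝟘 = 𝟘
𝟙 ∧₃ 𝟙 = 𝟙

J₀₃ J₁₃ J₂₃ : Three → Three
J₀₃ 𝟘 = 𝟙
J₀₃ ½ = 𝟘
J₀₃ 𝟙 = 𝟘
J₁₃ 𝟘 = 𝟘
J₁₃ ½ = 𝟙
J₁₃ 𝟙 = 𝟘
J₂₃ 𝟘 = 𝟘
J₂₃ ½ = 𝟘
J₂₃ 𝟙 = 𝟙

record WKAlg (c ℓ : Level) : Set (suc (c ⊔ ℓ)) where
  field
    Carrier : Set c
    _≈_     : Carrier → Carrier → Set ℓ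
    isEquivalence : IsEquivalence _≈_
    neg     : Carrier → Carrier
    _∨_ _∧_ : Carrier → Carrier → Carrier
    zero one : Carrier
    neg-cong : ∀ {x y} → x ≈ y → neg x ≈ neg y
    ∨-cong   : ∀ {x y u v} → x ≈ y → u ≈ v → (x ∨ u) ≈ (y ∨ v)
    ∧-cong   : ∀ {x y u v} → x ≈ y → u ≈ v → (x ∧ u) ≈ (y ∧ v)

record WKeAlg (c ℓ : Level) : Set (suc (c ⊔ ℓ)) where
  field
    reduct : WKAlg c ℓ
  open WKAlg reduct public
  field
    J₀ J₁ J₂ : Carrier → Carrier
    J₀-cong : ∀ {x y} → x ≈ y → J₀ x ≈ J₀ y
    J₁-cong : ∀ {x y} → x ≈ y → J₁ x ≈ J₁ y
    J₂-cong : ∀ {x y} → x ≈ y → J₂ x ≈ J₂ y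

freeReduct : ∀ {c ℓ} → WKeAlg c ℓ → WKAlg c ℓ
freeReduct A = WKeAlg.reduct A

-- BCA = ISP(WK^e): A embeds (via a homomorphism that is injective w.r.t.
-- the setoid equality) into a power (WK^e)^I, for some index set I.
-- A map into the power is given by its family of coordinate maps.

record IsWKeHom {c ℓ} (A : WKeAlg c ℓ) (h : WKeAlg.Carrier A → Three) : Set (c ⊔ ℓ) where
  open WKeAlg A
  field
    resp  : ∀ {x y} → x ≈ y → h x ≡ h y
    h-neg : ∀ x → h (neg x) ≡ ¬₃ (h x)
    h-∨   : ∀ x y → h (x ∨ y) ≡ h x ∨₃ h y
    h-∧   : ∀ x y → h (x ∧ y) ≡ h x ∧₃ h y
    h-J₀  : ∀ x → h (J₀ x) ≡ J₀₃ (h x)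
    h-J₁  : ∀ x → h (J₁ x) ≡ J₁₃ (h x)
    h-J₂  : ∀ x → h (J₂ x) ≡ J₂₃ (h x)
    h-0   : h zero ≡ 𝟘
    h-1   : h one ≡ 𝟙

record InBCA (ι : Level) {c ℓ} (A : WKeAlg c ℓ) : Set (suc ι ⊔ c ⊔ ℓ) where
  open WKeAlg A
  field
    I     : Set ι
    h     : I → Carrier → Three
    isHom : ∀ i → IsWKeHom A (h i)
    inj   : ∀ x y → (∀ i → h i x ≡ h i y) → x ≈ y

record Ultrafilter {ι} (J : Set ι) : Set (suc ι) where
  field
    U        : (J → Set ι) → Set ι
    upward   : ∀ {X Y : J → Set ι} → (∀ j → X j → Y j) → U X → U Y
    meet     : ∀ {X Y : J → Set ι} → U X → U Y → U (λ j → X j × Y j)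
    top      : U (λ _ → Lift ι ⊤')
    proper   : ¬ U (λ _ → Lift ι ⊥)
    ultra    : ∀ (X : J → Set ι) → ¬ U X → U (λ j → ¬ X j)

-- The ultrapower WK^J / U: carrier J → Three, equality "agree on a U-large set",
-- operations pointwise.  A map into a product of ultrapowers of WK is given by
-- its family of coordinate maps.

record IsWKHomToUltrapower {c ℓ ι} (A : WKAlg c ℓ) {J : Set ι} (F : Ultrafilter J)
         (h : WKAlg.Carrier A → (J → Three)) : Set (c ⊔ ℓ ⊔ ι) where
  open WKAlg A
  open Ultrafilter F
  _~_ : (J → Three) → (J → Three) → Set ι
  f ~ g = U (λ j → Lift ι (f j ≡ g j))
  field
    resp  : ∀ {x y} → x ≈ y → h x ~ h y
    h-neg : ∀ x → h (neg x) ~ (λ j → ¬₃ (h x j))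
    h-∨   : ∀ x y → h (x ∨ y) ~ (λ j → h x j ∨₃ h y j)
    h-∧   : ∀ x y → h (x ∧ y) ~ (λ j → h x j ∧₃ h y j)
    h-0   : h zero ~ (λ _ → 𝟘)
    h-1   : h one ~ (λ _ → 𝟙)

-- SIBSL = ISP P_u(WK): A embeds into a product (indexed by I) of ultrapowers of WK.
record InSIBSL (ι : Level) {c ℓ} (A : WKAlg c ℓ) : Set (suc ι ⊔ c ⊔ ℓ) where
  open WKAlg A
  field
    I     : Set ι
    J     : I → Set ι
    F     : ∀ i → Ultrafilter (J i)
    h     : ∀ i → Carrier → (J i → Three)
    isHom : ∀ i → IsWKHomToUltrapower A (F i) (h i)
    inj   : ∀ x y → (∀ i → Ultrafilter.U (F i) (λ j → Lift ι (h i x j ≡ h i y j))) → x ≈ y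

-- WK is the {J₀,J₁,J₂}-free reduct of WK^e, so forgetting the J's turns an embedding
-- of A into a power of WK^e into an embedding of the reduct of A into a power of WK,
-- i.e. the reduct lies in ISP(WK).  Finally ISP(WK) ⊆ ISPP_u(WK), since WK is
-- isomorphic to its ultrapower by the principal ultrafilter on a one-point set.
module Submission where

open import Defs
open import Level using (Level; _⊔_; Lift; lift; lower) renaming (suc to lsuc)
open import Data.Unit using (tt) renaming (⊤ to ⊤')
open import Data.Product using (_,_)
open import Relation.Binary.PropositionalEquality using (_≡_)

principalUltrafilter : ∀ {ι} {J : Set ι} → J → Ultrafilter J
principalUltrafilter j = record
  { U      = λ X → X j
  ; upward = λ X⊆Y → X⊆Y j
  ; meet   = _,_
  ; top    = lift tt
  ; proper = λ ()
  ; ultra  = λ _ ¬Xj → ¬Xj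
  }

record IsWKHom {c ℓ} (A : WKAlg c ℓ) (h : WKAlg.Carrier A → Three) : Set (c ⊔ ℓ) where
  open WKAlg A
  field
    resp  : ∀ {x y} → x ≈ y → h x ≡ h y
    h-neg : ∀ x → h (neg x) ≡ ¬₃ (h x)
    h-∨   : ∀ x y → h (x ∨ y) ≡ h x ∨₃ h y
    h-∧   : ∀ x y → h (x ∧ y) ≡ h x ∧₃ h y
    h-0   : h zero ≡ 𝟘
    h-1   : h one ≡ 𝟙

record InISP-WK (ι : Level) {c ℓ} (A : WKAlg c ℓ) : Set (lsuc ι ⊔ c ⊔ ℓ) where
  open WKAlg A
  field
    I     : Set ι
    h     : I → Carrier → Three
    isHom : ∀ i → IsWKHom A (h i)
    inj   : ∀ x y → (∀ i → h i x ≡ h i y) → x ≈ y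

IsWKeHom⇒IsWKHom : ∀ {c ℓ} {A : WKeAlg c ℓ} {h : WKeAlg.Carrier A → Three} →
                   IsWKeHom A h → IsWKHom (freeReduct A) h
IsWKeHom⇒IsWKHom isHom = record
  { resp = resp ; h-neg = h-neg ; h-∨ = h-∨ ; h-∧ = h-∧ ; h-0 = h-0 ; h-1 = h-1 }
  where open IsWKeHom isHom

InBCA⇒freeReduct-InISP-WK : ∀ {c ℓ ι} {A : WKeAlg c ℓ} → InBCA ι A → InISP-WK ι (freeReduct A)
InBCA⇒freeReduct-InISP-WK A∈BCA = record
  { I = I ; h = h ; isHom = λ i → IsWKeHom⇒IsWKHom (isHom i) ; inj = inj }
  where open InBCA A∈BCA

IsWKHom⇒IsWKHomToPrincipalUltrapower :
  ∀ {c ℓ ι} {A : WKAlg c ℓ} {J : Set ι} (j : J) {h : WKAlg.Carrier A → Three} →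
  IsWKHom A h → IsWKHomToUltrapower A (principalUltrafilter j) (λ x _ → h x)
IsWKHom⇒IsWKHomToPrincipalUltrapower j isHom = record
  { resp  = λ x≈y → lift (resp x≈y)
  ; h-neg = λ x → lift (h-neg x)
  ; h-∨   = λ x y → lift (h-∨ x y)
  ; h-∧   = λ x y → lift (h-∧ x y)
  ; h-0   = lift h-0
  ; h-1   = lift h-1
  }
  where open IsWKHom isHom

InISP-WK⇒InSIBSL : ∀ {c ℓ ι} {A : WKAlg c ℓ} → InISP-WK ι A → InSIBSL ι A
InISP-WK⇒InSIBSL {ι = ι} A∈ISP = record
  { I     = I
  ; J     = λ _ → Lift ι ⊤'
  ; F     = λ _ → principalUltrafilter (lift tt)
  ; h     = λ i x _ → h i x
  ; isHom = λ i → IsWKHom⇒IsWKHomToPrincipalUltrapower (lift tt) (isHom i)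
  ; inj   = λ x y agree → inj x y (λ i → lower (agree i))
  }
  where open InISP-WK A∈ISP

proposition2p5 : ∀ {c ℓ ι : Level} (A : WKeAlg c ℓ) → InBCA ι A → InSIBSL ι (freeReduct A)
proposition2p5 A A∈BCA = InISP-WK⇒InSIBSL (InBCA⇒freeReduct-InISP-WK A∈BCA)
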